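{- Let $T = \langle S, Act, \to\rangle$ be a labelled transition system. Then for all states $s, s' \in S$: $s$ and $s'$ are bisimilar in $T$ if and only if $s$ and $s'$ are bisimilar in the Kripke structure $\mathsf{ks}(T)$.
   Context: A Kripke structure is $K=\langle S, AP, \to, L\rangle$ with $S$ a set of states, $AP$ a set of atomic propositions, $\to\,\subseteq S\times S$ a total transition relation (for every $s\in S$ there is $t\in S$ with $s\to t$), and $L: S\to 2^{AP}$ a state labelling. A labelled transition system (LTS) is $T=\langle S, Act, \to\rangle$ with $S$ a set of states, $Act$ a set of actions, a special silent action $\tau\notin Act$, and a transition relation $\to\,\subseteq S\times(Act\cup\{\tau\})\times S$ that is total (for every $s\in S$ there are $a\in Act$, $t\in S$ with $s\xrightarrow{a}t$). The embedding $\mathsf{ks}$: for an LTS $T=\langle S,Act,\to\rangle$, $\mathsf{ks}(T)=\langle S', AP, \to', L\rangle$ where $S' = S\cup\{(s,a,t)\in\,\to \mid a\neq\tau\}$, $AP = Act\cup\{\bot\}$ with $\bot\notin Act$ fresh, $\to'$ is the least relation such that for every transition $(s,a,t)$ with $a\neq\tau$ we have $s\to'(s,a,t)$ and $(s,a,t)\to' t$, and $s\to' t$ whenever $s\xrightarrow{\tau}t$; and $L(s)=\{\bot\}$ for $s\in S$, $L((s,a,t))=\{a\}$. Simulation in a Kripke structure: a relation $B\subseteq S\times S$ is a simulation iff for all $(s,s')\in B$: $L(s)=L(s')$, and for every $t$ with $s\to t$ there is $t'$ with $s'\to t'$ and $(t,t')\in B$. Simulation in an LTS: $B\subseteq S\times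 S$ is a simulation iff for all $(s,s')\in B$, all $a\in Act\cup\{\tau\}$ and all $t$ with $s\xrightarrow{a}t$ there is $t'$ with $s'\xrightarrow{a}t'$ and $(t,t')\in B$. In either setting, states $s,s'$ are bisimilar iff there is a symmetric simulation relation $B$ with $(s,s')\in B$. -}

module Defs where

open import Data.Maybe using (Maybe; just; nothing)
open import Data.Product using (Σ; ∃; _×_; _,_)
open import Function.Bundles using (_⇔_)
open import Relation.Binary.PropositionalEquality using (_≡_)

-- Labelled transition system. Labels of type Maybe Act: `just a` is a visible
-- action a ∈ Act, `nothing` is the silent action τ ∉ Act.
record LTS : Set₁ where
  field
    State : Set
    Act   : Set
    Step  : State → Maybe Act → State → Set
    total : ∀ s → Σ Act λ a → Σ State λ t → Step s (just a) t

record Kripke : Set₁ where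
  field
    State : Set
    AP    : Set
    _⟶_   : State → State → Set
    L     : State → AP → Set
    total : ∀ s → Σ State λ t → s ⟶ t

module _ (T : LTS) where
  open LTS T

  IsSimulationLTS : (State → State → Set) → Set
  IsSimulationLTS B = ∀ {s s'} → B s s' → ∀ (a : Maybe Act) t → Step s a t →
    Σ State λ t' → Step s' a t' × B t t'

  BisimilarLTS : State → State → Set₁
  BisimilarLTS s s' = Σ (State → State → Set) λ B →
    (∀ {x y} → B x y → B y x) × IsSimulationLTS B × B s s'

module _ (K : Kripke) where
  open Kripke K

  SameLabel : State → State → Set
  SameLabel s s' = ∀ p → L s p ⇔ L s' p

  IsSimulationKS : (State → State → Set) → Set
  IsSimulationKS B = ∀ {s s'} → B s s' →
    SameLabel s s' × (∀ t → s ⟶ t → Σ State λ t' → (s' ⟶ t') × B t t')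

  BisimilarKS : State → State → Set₁
  BisimilarKS s s' = Σ (State → State → Set) λ B →
    (∀ {x y} → B x y → B y x) × IsSimulationKS B × B s s'

module _ (T : LTS) where
  open LTS T

  data KState : Set where
    st : State → KState
    tr : (s : State) (a : Act) (t : State) → Step s (just a) t → KState

  data KStep : KState → KState → Set where
    into  : ∀ {s a t} (p : Step s (just a) t) → KStep (st s) (tr s a t p)
    outof : ∀ {s a t} (p : Step s (just a) t) → KStep (tr s a t p) (st t)
    silent : ∀ {s t} → Step s nothing t → KStep (st s) (st t)

  -- AP = Act ∪ {⊥}, with `nothing` playing the role of the fresh ⊥
  KLabel : KState → Maybe Act → Set
  KLabel (st s) p = p ≡ nothing
  KLabel (tr s a t _) p = p ≡ just a

  KTotal : ∀ x → Σ KState λ y → KStep x y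
  KTotal (st s) with total s
  ... | a , t , p = tr s a t p , into p
  KTotal (tr s a t p) = st t , outof p

ks : LTS → Kripke
ks T = record
  { State = KState T
  ; AP = Maybe (LTS.Act T)
  ; _⟶_ = KStep T
  ; L = KLabel T
  ; total = KTotal T
  }

module Submission where

-- (⇒) A relation B on LTS states is lifted to ks(T) by relating plain states
--     as B does, and transition states (s,a,t), (s',a',t') when a ≡ a' and
--     B t t'.  The lift of a symmetric relation is symmetric, relates only
--     equally labelled states, and the lift of an LTS simulation is a
--     Kripke simulation.
-- (⇐) A Kripke relation R is restricted to plain states.  Labels of ks(T)
--     record the action of a transition state (⊥, i.e. `nothing`, for plain
--     states), so equally labelled states carry the same action.  Hence an
--     a-step s → t, encoded as s ⟶ (s,a,t) ⟶ t, must be matched in ks(T) by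
--     s' ⟶ (s',a,t') ⟶ t', and a τ-step by a direct plain step: the
--     restriction of a Kripke simulation is an LTS simulation.

open import Defs
open import Function.Bundles using (_⇔_; mk⇔; Equivalence)
open import Function.Construct.Identity using (⇔-id)
open import Data.Maybe using (Maybe; just; nothing)
open import Data.Maybe.Properties using (just-injective)
open import Data.Product using (Σ; _×_; _,_; proj₁; proj₂)
open import Data.Empty using (⊥)
open import Relation.Binary.PropositionalEquality using (_≡_; refl; sym)

module _ (T : LTS) where
  open LTS T

  K : Kripke
  K = ks T

  Rel : Set → Set₁
  Rel A = A → A → Set

  actionOf : KState T → Maybe Act
  actionOf (st _)       = nothing
  actionOf (tr _ a _ _) = just a

  label-is-action : ∀ x p → KLabel T x p → p ≡ actionOf x
  label-is-action (st _)       _ eq = eq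
  label-is-action (tr _ _ _ _) _ eq = eq

  action-is-label : ∀ x → KLabel T x (actionOf x)
  action-is-label (st _)       = refl
  action-is-label (tr _ _ _ _) = refl

  sameLabel⇒sameAction : ∀ x y → SameLabel K x y → actionOf x ≡ actionOf y
  sameLabel⇒sameAction x y same =
    label-is-action y (actionOf x)
      (Equivalence.to (same (actionOf x)) (action-is-label x))

  lift : Rel State → Rel (KState T)
  lift B (st x)         (st y)           = B x y
  lift B (tr _ a y _)   (tr _ a' y' _)   = (a ≡ a') × B y y'
  lift B _              _                = ⊥

  lift-symmetric : ∀ {B : Rel State} → (∀ {x y} → B x y → B y x) →
                   ∀ {x y} → lift B x y → lift B y x
  lift-symmetric sym-B {st _}       {st _}       b        = sym-B b
  lift-symmetric sym-B {tr _ _ _ _} {tr _ _ _ _} (e , b)  = sym e , sym-B b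

  -- Lifted pairs always carry the same action, hence the same label.
  lift-sameLabel : ∀ {B x y} → lift B x y → SameLabel K x y
  lift-sameLabel {x = st _}       {st _}       _        _ = ⇔-id _
  lift-sameLabel {x = tr _ _ _ _} {tr _ _ _ _} (refl , _) _ = ⇔-id _

  -- The lift of an LTS simulation is a Kripke simulation: an entry step into
  -- (x,a,t) is answered by the matching a-step of the LTS, a τ-step by the
  -- matching τ-step, and the exit step of (x,a,t) by the exit of the partner.
  lift-simulation : ∀ {B} → IsSimulationLTS T B → IsSimulationKS K (lift B)
  lift-simulation {B} sim {x} {y} b = lift-sameLabel {B} {x} {y} b , answer x y b
    where
    answer : ∀ x y → lift B x y → ∀ t → KStep T x t →
             Σ (KState T) λ t' → KStep T y t' × lift B t t'
    answer (st _) (st y) b _ (into {a = a} {t = t} p) with sim b (just a) t p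
    ... | t' , q , b' = tr y a t' q , into q , refl , b'
    answer (st _) (st y) b _ (silent {t = t} p) with sim b nothing t p
    ... | t' , q , b' = st t' , silent q , b'
    answer (tr _ _ _ _) (tr _ _ y' p') (_ , b) _ (outof _) = st y' , outof p' , b

  restrict : Rel (KState T) → Rel State
  restrict R x y = R (st x) (st y)

  -- A τ-step
  -- cannot be answered by entering a transition state (labels ⊥ vs. {c}); an
  -- a-step's entry into (x,a,t) must be answered by entering some (y,a,u),
  -- whose unique exit step then answers the exit to t.
  restrict-simulation : ∀ {R} → IsSimulationKS K R → IsSimulationLTS T (restrict R)
  restrict-simulation sim {x} {y} r nothing t p
    with proj₂ (sim r) (st t) (silent p)
  ... | st u , silent q , r' = u , q , r'
  ... | z@(tr _ _ _ _) , into _ , r' with sameLabel⇒sameAction (st t) z (proj₁ (sim r'))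
  ... | ()
  restrict-simulation sim {x} {y} r (just a) t p
    with proj₂ (sim r) (tr x a t p) (into p)
  ... | z@(st _) , silent _ , r' with sameLabel⇒sameAction (tr x a t p) z (proj₁ (sim r'))
  ...   | ()
  restrict-simulation sim {x} {y} r (just a) t p
      | z@(tr _ c u q) , into _ , r'
      with just-injective (sameLabel⇒sameAction (tr x a t p) z (proj₁ (sim r')))
  ...   | refl with proj₂ (sim r') (st t) (outof p)
  ...     | st _ , outof _ , r'' = u , q , r''

  bisimilar⇒ks-bisimilar : ∀ {s s'} → BisimilarLTS T s s' → BisimilarKS K (st s) (st s')
  bisimilar⇒ks-bisimilar (B , sym-B , sim , b) =
    lift B , (λ {x} {y} → lift-symmetric {B} sym-B {x} {y}) , lift-simulation sim , b

  ks-bisimilar⇒bisimilar : ∀ {s s'} → BisimilarKS K (st s) (st s') → BisimilarLTS T s s'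
  ks-bisimilar⇒bisimilar (R , sym-R , sim , r) =
    restrict R , sym-R , restrict-simulation sim , r

theorem3p10 : (T : LTS) (s s' : LTS.State T) →
    BisimilarLTS T s s' ⇔ BisimilarKS (ks T) (st s) (st s')
theorem3p10 T s s' = mk⇔ (bisimilar⇒ks-bisimilar T) (ks-bisimilar⇒bisimilar T)
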